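{- Let $\tau$ be a finite unary vocabulary, $c_\tau := 15|\tau|2^{|\tau|}$, $d$ a positive integer, $\mathfrak{M}$ a $\tau$-model of size $n$, and $h\in\{1,\dots,d-1\}$. If $H_B^d(\mathfrak{M}) < \log\binom{n}{h}$, then $C_d(\mathfrak{M}) < 6h + c_\tau$.
   Context: All logarithms are base 2. A $\tau$-model of size $n$ has domain $\{1,\dots,n\}$ and interprets each unary symbol as a subset. A type is a subset $\pi\subseteq\tau$; $|\pi|_{\mathfrak{M}}$ is the number of points in exactly the relations named in $\pi$. For models of size $n$, $\mathfrak{M}\equiv_d\mathfrak{M}'$ iff every type $\pi$ with $|\pi|_{\mathfrak{M}}<d$ has $|\pi|_{\mathfrak{M}}=|\pi|_{\mathfrak{M}'}$. $H_B^d(\mathfrak{M}) = \log|\mathcal{M}|$ where $\mathcal{M}$ is the $\equiv_d$-class of $\mathfrak{M}$ among $\tau$-models with domain $\{1,\dots,n\}$. $\mathrm{FO}_d[\tau]$ is first-order logic (negation normal form) of quantifier rank at most $d$; size counts atomic formulas (negated or not), conjunctions, disjunctions and quantifiers, not negations. $C_d(\mathfrak{M})$ is the minimum size of an $\mathrm{FO}_d[\tau]$-sentence true in exactly the $\tau$-models of size $n$ that are $\equiv_d$-equivalent to $\mathfrak{M}$. -}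

module Defs where

open import Data.Nat using (ℕ; zero; suc; _+_; _*_; _^_; _<_; _≤_; _⊔_)
open import Data.Nat.Properties using (_<?_) renaming (_≟_ to _≟ℕ_)
open import Data.Bool using (Bool; true; false) renaming (_≟_ to _≟B_)
open import Data.Fin using (Fin; zero; suc)
open import Data.Fin.Subset using (Subset; inside; outside)
open import Data.Fin.Subset.Properties using (anySubset?)
open import Data.List using (List; []; _∷_; [_]; map; concatMap; filter; length; allFin)
open import Data.Vec using (Vec; lookup) renaming ([] to []ᵥ; _∷_ to _∷ᵥ_)
import Data.Vec as Vec
open import Data.Vec.Properties using (≡-dec)
open import Data.Product using (Σ; _×_; _,_; ∃)
open import Relation.Nullary using (Dec; yes; no; ¬_)
open import Relation.Nullary.Decidable using (_→-dec_; ¬?; decidable-stable)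
open import Relation.Binary.PropositionalEquality using (_≡_)

-- Vocabulary τ with k = |τ| unary symbols, named by Fin k.
-- A τ-model of size n (domain {1..n} represented by Fin n) interprets
-- each unary symbol as a subset of the domain.

Model : ℕ → ℕ → Set
Model k n = Vec (Subset n) k

-- A type π ⊆ τ is a subset of the symbols.
Type : ℕ → Set
Type k = Subset k

pointType : ∀ {k n} → Model k n → Fin n → Type k
pointType M i = Vec.map (λ S → lookup S i) M

count : ∀ {k n} → Model k n → Type k → ℕ
count {n = n} M π = length (filter (λ i → ≡-dec _≟B_ (pointType M i) π) (allFin n))

_≡[_]_ : ∀ {k n} → Model k n → ℕ → Model k n → Set
M ≡[ d ] M' = ∀ π → count M π < d → count M π ≡ count M' π

≡d? : ∀ {k n} (d : ℕ) (M M' : Model k n) → Dec (M ≡[ d ] M')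
≡d? d M M' with anySubset? (λ π → ¬? ((count M π <? d) →-dec (count M π ≟ℕ count M' π)))
... | yes (π , p) = no (λ h → p (h π))
... | no ¬e = yes (λ π → decidable-stable ((count M π <? d) →-dec (count M π ≟ℕ count M' π))
                                         (λ q → ¬e (π , q)))

allVecs : ∀ {A : Set} → List A → (k : ℕ) → List (Vec A k)
allVecs xs zero = [ []ᵥ ]
allVecs xs (suc k) = concatMap (λ x → map (x ∷ᵥ_) (allVecs xs k)) xs

allSubsets : (n : ℕ) → List (Subset n)
allSubsets n = allVecs (inside ∷ outside ∷ []) n

allModels : (k n : ℕ) → List (Model k n)
allModels k n = allVecs (allSubsets n) k

-- |𝓜| : size of the ≡_d-class of M among τ-models with domain {1..n}.
-- H_B^d(M) = log classSize.
classSize : ∀ {k n} → ℕ → Model k n → ℕ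
classSize {k} {n} d M = length (filter (λ M' → ≡d? d M M') (allModels k n))

-- First-order logic in negation normal form over τ (with equality),
-- formulas with m free variables (de Bruijn indices Fin m).

data Formula (k : ℕ) : ℕ → Set where
  rel  : ∀ {m} → Fin k → Fin m → Formula k m
  nrel : ∀ {m} → Fin k → Fin m → Formula k m
  eq   : ∀ {m} → Fin m → Fin m → Formula k m
  neq  : ∀ {m} → Fin m → Fin m → Formula k m
  _∧ᶠ_ : ∀ {m} → Formula k m → Formula k m → Formula k m
  _∨ᶠ_ : ∀ {m} → Formula k m → Formula k m → Formula k m
  all  : ∀ {m} → Formula k (suc m) → Formula k m
  ex   : ∀ {m} → Formula k (suc m) → Formula k m

Sentence : ℕ → Set
Sentence k = Formula k 0

qr : ∀ {k m} → Formula k m → ℕ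
qr (rel _ _) = 0
qr (nrel _ _) = 0
qr (eq _ _) = 0
qr (neq _ _) = 0
qr (φ ∧ᶠ ψ) = qr φ ⊔ qr ψ
qr (φ ∨ᶠ ψ) = qr φ ⊔ qr ψ
qr (all φ) = suc (qr φ)
qr (ex φ) = suc (qr φ)

size : ∀ {k m} → Formula k m → ℕ
size (rel _ _) = 1
size (nrel _ _) = 1
size (eq _ _) = 1
size (neq _ _) = 1
size (φ ∧ᶠ ψ) = suc (size φ + size ψ)
size (φ ∨ᶠ ψ) = suc (size φ + size ψ)
size (all φ) = suc (size φ)
size (ex φ) = suc (size φ)

extend : ∀ {n m} → (Fin m → Fin n) → Fin n → Fin (suc m) → Fin n
extend ρ a zero = a
extend ρ a (suc x) = ρ x

Sat : ∀ {k n m} → Model k n → (Fin m → Fin n) → Formula k m → Set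
Sat M ρ (rel r x) = lookup (lookup M r) (ρ x) ≡ true
Sat M ρ (nrel r x) = ¬ (lookup (lookup M r) (ρ x) ≡ true)
Sat M ρ (eq x y) = ρ x ≡ ρ y
Sat M ρ (neq x y) = ¬ (ρ x ≡ ρ y)
Sat M ρ (φ ∧ᶠ ψ) = Sat M ρ φ × Sat M ρ ψ
Sat {n = n} M ρ (φ ∨ᶠ ψ) = Data.Sum._⊎_ (Sat M ρ φ) (Sat M ρ ψ)
  where import Data.Sum
Sat {n = n} M ρ (all φ) = (a : Fin n) → Sat M (extend ρ a) φ
Sat {n = n} M ρ (ex φ) = Σ (Fin n) (λ a → Sat M (extend ρ a) φ)

_⊨_ : ∀ {k n} → Model k n → Sentence k → Set
M ⊨ φ = Sat M (λ ()) φ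

Defines : ∀ {k n} → ℕ → Model k n → Sentence k → Set
Defines {k} {n} d M φ = (M' : Model k n) → (M' ⊨ φ → M ≡[ d ] M') × (M ≡[ d ] M' → M' ⊨ φ)

cτ : ℕ → ℕ
cτ k = 15 * k * 2 ^ k

-- If some type π₀ covers more than n − h points, the other types together have
-- fewer than h < d points, so each of their counts is below d and must be kept by
-- ≡_d; and since all counts add up to n, fixing them also fixes the count of π₀.
-- The ≡_d-class of M is thus defined by saying, for each type π ≠ π₀, that exactly
-- count M π points have type π, which costs about 6 · count M π + 4|τ| symbols
-- and quantifier rank count M π + 1.
-- Otherwise every type has at most n − h points.  Rearranging the points of M gives
-- models with the same counts, hence ≡_d M, and their number is the multinomial
-- coefficient of the counts.  With all parts at most n − h, Pascal's rule shows
-- that it is at least C(n, h), contradicting the hypothesis.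
module Submission where

open import Data.Bool using (Bool; true; false; not)
open import Data.Bool.Properties using (¬-not; not-¬) renaming (_≟_ to _≟B_)
open import Data.Fin using (Fin; zero; suc; fromℕ<)
open import Data.Fin.Properties using (any?; ¬∀⟶∃¬; injective⇒≤) renaming (_≟_ to _≟F_)
open import Data.Fin.Subset using (Subset; inside; outside)
open import Data.Fin.Subset.Properties using (anySubset?)
open import Data.List
  using (List; []; _∷_; [_]; _++_; length; map; filter; concatMap; deduplicate; allFin; cartesianProductWith; foldr)
import Data.List as List
open import Data.List.Extrema.Nat using (argmax; argmax-all; f[⊥]≤f[argmax]; f[xs]≤f[argmax])
open import Data.List.Membership.Propositional using (_∈_; _∉_; find; lose)
open import Data.List.Membership.Propositional.Properties
  using (∈-lookup; ∈-map⁻; ∈-map⁺; ∈-++⁻; ∈-concatMap⁺; ∈-concatMap⁻; ∈-deduplicate⁺; ∈-deduplicate⁻;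
         ∈-cartesianProductWith⁺; ∈-filter⁺; ∈-filter⁻; ∈-allFin; ∈-tabulate⁺)
open import Data.List.Properties
  using (length-++; length-map; length-filter; length-tabulate; map-cong; map-cong-local; map-tabulate;
         filter-++; filter-accept; filter-reject; filter-all; filter-none)
open import Data.List.Relation.Binary.Disjoint.Propositional using (Disjoint)
open import Data.List.Relation.Binary.Permutation.Propositional using (_↭_; ↭-refl; ↭-sym; ↭-trans; ↭-prep; ↭-swap)
open import Data.List.Relation.Binary.Permutation.Propositional.Properties using (↭-length; filter-↭)
open import Data.List.Relation.Binary.Subset.Propositional using (_⊆_)
open import Data.List.Relation.Unary.All as All using (All; []; _∷_)
import Data.List.Relation.Unary.All.Properties as All
import Data.List.Relation.Unary.AllPairs as AllPairs
import Data.List.Relation.Unary.AllPairs.Properties as AllPairs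
open import Data.List.Relation.Unary.Any as Any using (Any; here; there)
import Data.List.Relation.Unary.Any.Properties as Any
open import Data.List.Relation.Unary.Unique.Propositional using (Unique; []; _∷_)
import Data.List.Relation.Unary.Unique.Propositional.Properties as Unique
open import Data.Nat using (ℕ; zero; suc; _+_; _*_; _^_; _∸_; _≤_; _<_; _⊔_; z≤n; s≤s; _≤?_; _<?_)
open import Data.Nat.Combinatorics using (_C_; nCn≡1; nCk+nC[k+1]≡[n+1]C[k+1]; k>n⇒nCk≡0)
open import Data.Nat.ListAction using (sum)
open import Data.Nat.Properties
open import Algebra.Properties.CommutativeSemigroup +-commutativeSemigroup using (interchange; x∙yz≈y∙xz)
open import Data.Nat.Tactic.RingSolver using (solve-∀)
open import Data.Product using (Σ; ∃; _×_; _,_; proj₁; proj₂)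
open import Data.Product.Function.NonDependent.Propositional using (_×-⇔_)
open import Data.Sum using (_⊎_; inj₁; inj₂; [_,_]′)
import Data.Sum as Sum
open import Data.Sum.Function.Propositional using (_⊎-⇔_)
open import Data.Vec using (Vec; lookup; tabulate; replicate; toList) renaming ([] to []ᵥ; _∷_ to _∷ᵥ_)
open import Data.Vec.Properties
  using (∷-injective; ∷-injectiveˡ; ∷-injectiveʳ; ≡-dec; lookup-map; lookup∘tabulate; tabulate∘lookup; tabulate-cong)
open import Defs
open import Function using (_∘_; id; Injective; _⇔_; mk⇔; Equivalence)
open import Function.Properties.Equivalence using () renaming (trans to ⇔-trans)
open import Relation.Binary.Definitions using (DecidableEquality)
open import Relation.Binary.PropositionalEquality hiding ([_])
open import Relation.Nullary using (yes; no; ¬_; ¬?; does; contradiction)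
open import Relation.Nullary.Decidable using (_×-dec_; decidable-stable; toSum)
open import Relation.Unary using (Decidable)

open Equivalence using (to; from)

Unique-lookup-injective : ∀ {A : Set} {xs : List A} → Unique xs →
                          ∀ {i j} → List.lookup xs i ≡ List.lookup xs j → i ≡ j
Unique-lookup-injective (_ ∷ _) {zero} {zero} _ = refl
Unique-lookup-injective (x≢ ∷ _) {zero} {suc j} same = contradiction same (All.lookup x≢ (∈-lookup j))
Unique-lookup-injective (x≢ ∷ _) {suc i} {zero} same = contradiction (sym same) (All.lookup x≢ (∈-lookup i))
Unique-lookup-injective (_ ∷ xs!) {suc i} {suc j} same = cong suc (Unique-lookup-injective xs! same)

Unique-⊆⇒length-≤ : ∀ {A : Set} {xs ys : List A} → Unique xs → xs ⊆ ys → length xs ≤ length ys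
Unique-⊆⇒length-≤ {xs = xs} {ys} xs! xs⊆ys = injective⇒≤ position-injective
  where
  position : Fin (length xs) → Fin (length ys)
  position i = Any.index (xs⊆ys (∈-lookup i))

  lookup-position : ∀ i → List.lookup xs i ≡ List.lookup ys (position i)
  lookup-position i = Any.lookup-index (xs⊆ys (∈-lookup i))

  position-injective : Injective _≡_ _≡_ position
  position-injective {i} {j} same = Unique-lookup-injective xs!
    (trans (lookup-position i) (trans (cong (List.lookup ys) same) (sym (lookup-position j))))

length-filter-map : ∀ {A B : Set} {P : B → Set} (P? : Decidable P) (f : A → B) xs →
                    length (filter P? (map f xs)) ≡ length (filter (P? ∘ f) xs)
length-filter-map P? f [] = refl
length-filter-map P? f (x ∷ xs) with does (P? (f x))
... | true = cong suc (length-filter-map P? f xs)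
... | false = length-filter-map P? f xs

sum-map-+ : ∀ {A : Set} (f g : A → ℕ) xs → sum (map (λ x → f x + g x) xs) ≡ sum (map f xs) + sum (map g xs)
sum-map-+ f g [] = refl
sum-map-+ f g (x ∷ xs) = trans (cong (f x + g x +_) (sum-map-+ f g xs)) (interchange (f x) (g x) _ _)

sum-map-≡0 : ∀ {A : Set} {f : A → ℕ} {xs} → All (λ x → f x ≡ 0) xs → sum (map f xs) ≡ 0
sum-map-≡0 [] = refl
sum-map-≡0 (fx≡0 ∷ fxs≡0) = cong₂ _+_ fx≡0 (sum-map-≡0 fxs≡0)

∈⇒1≤length : ∀ {B : Set} {y : B} {ys} → y ∈ ys → 1 ≤ length ys
∈⇒1≤length (here _) = s≤s z≤n
∈⇒1≤length (there _) = s≤s z≤n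

∈⇒≤sum-map : ∀ {A : Set} (f : A → ℕ) {x xs} → x ∈ xs → f x ≤ sum (map f xs)
∈⇒≤sum-map f (here refl) = m≤m+n _ _
∈⇒≤sum-map f {xs = y ∷ _} (there x∈) = ≤-trans (∈⇒≤sum-map f x∈) (m≤n+m _ (f y))

Π-⇔ : ∀ {A : Set} {P Q : A → Set} → (∀ x → P x ⇔ Q x) → (∀ x → P x) ⇔ (∀ x → Q x)
Π-⇔ P⇔Q = mk⇔ (λ p x → to (P⇔Q x) (p x)) (λ q x → from (P⇔Q x) (q x))

Σ-⇔ : ∀ {A : Set} {P Q : A → Set} → (∀ x → P x ⇔ Q x) → (∃ P) ⇔ (∃ Q)
Σ-⇔ P⇔Q = mk⇔ (λ (x , p) → x , to (P⇔Q x) p) (λ (x , q) → x , from (P⇔Q x) q)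

All-tabulate⇔ : ∀ {A : Set} {P : A → Set} {j} {f : Fin j → A} → All P (List.tabulate f) ⇔ (∀ i → P (f i))
All-tabulate⇔ = mk⇔ All.tabulate⁻ All.tabulate⁺

Any-tabulate⇔ : ∀ {A : Set} {P : A → Set} {j} {f : Fin j → A} → Any P (List.tabulate f) ⇔ (∃ λ i → P (f i))
Any-tabulate⇔ = mk⇔ Any.tabulate⁻ (λ (i , p) → Any.tabulate⁺ i p)

m≤n∧m+n≤o+1+p⇒m≤o⊔p : ∀ {m n o p} → m ≤ n → m + n ≤ o + suc p → m ≤ o ⊔ p
m≤n∧m+n≤o+1+p⇒m≤o⊔p {m} {n} {o} {p} m≤n m+n≤ with m ≤? p
... | yes m≤p = m≤n⇒m≤o⊔n o m≤p
... | no m≰p = m≤n⇒m≤n⊔o p (≤-trans m≤n n≤o)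
  where
  n≤o : n ≤ o
  n≤o = +-cancelˡ-≤ m n o (≤-trans m+n≤ (≤-trans (+-monoʳ-≤ o (≰⇒> m≰p)) (≤-reflexive (+-comm o m))))

-- Multiplicities and rearrangements

module Multiplicity {A : Set} (_≟_ : DecidableEquality A) where

  open import Data.List.Membership.DecPropositional _≟_ using (_∈?_)
  open import Data.List.Relation.Unary.Unique.DecPropositional.Properties _≟_ using (deduplicate-!)

  mult : A → List A → ℕ
  mult t xs = length (filter (_≟ t) xs)

  mult-++ : ∀ t xs ys → mult t (xs ++ ys) ≡ mult t xs + mult t ys
  mult-++ t xs ys = trans (cong length (filter-++ (_≟ t) xs ys)) (length-++ (filter (_≟ t) xs))

  mult-↭ : ∀ t {xs ys} → xs ↭ ys → mult t xs ≡ mult t ys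
  mult-↭ t p = ↭-length (filter-↭ (_≟ t) p)

  mult-∉ : ∀ {t xs} → t ∉ xs → mult t xs ≡ 0
  mult-∉ {t} {xs} t∉xs =
    cong length (filter-none (_≟ t) (All.tabulate (λ x∈xs x≡t → t∉xs (subst (_∈ xs) x≡t x∈xs))))

  mult-All≡ : ∀ {t xs} → All (_≡ t) xs → mult t xs ≡ length xs
  mult-All≡ {t} all≡ = cong length (filter-all (_≟ t) all≡)

  mult-singleton-self : ∀ t → mult t [ t ] ≡ 1
  mult-singleton-self t = cong length (filter-accept (_≟ t) refl)

  mult-singleton-other : ∀ {s t} → s ≢ t → mult t [ s ] ≡ 0
  mult-singleton-other {t = t} s≢t = cong length (filter-reject (_≟ t) s≢t)

  sum-mult-singleton : ∀ {ts} s → Unique ts → s ∈ ts → sum (map (λ t → mult t [ s ]) ts) ≡ 1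
  sum-mult-singleton s (s≢ ∷ _) (here refl) =
    cong₂ _+_ (mult-singleton-self s) (sum-map-≡0 (All.map (λ s≢t → mult-singleton-other s≢t) s≢))
  sum-mult-singleton s (t≢ ∷ ts!) (there s∈) =
    cong₂ _+_ (mult-singleton-other (λ s≡t → All.lookup t≢ s∈ (sym s≡t))) (sum-mult-singleton s ts! s∈)

  sum-mult : ∀ {ts} ys → Unique ts → All (_∈ ts) ys → sum (map (λ t → mult t ys) ts) ≡ length ys
  sum-mult {ts} [] _ _ = sum-map-≡0 {f = λ t → mult t []} (All.universal (λ _ → refl) ts)
  sum-mult {ts} (y ∷ ys) ts! (y∈ ∷ ys∈) = begin
    sum (map (λ t → mult t (y ∷ ys)) ts)               ≡⟨ cong sum (map-cong (λ t → mult-++ t [ y ] ys) ts) ⟩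
    sum (map (λ t → mult t [ y ] + mult t ys) ts)      ≡⟨ sum-map-+ (λ t → mult t [ y ]) (λ t → mult t ys) ts ⟩
    sum (map (λ t → mult t [ y ]) ts) + sum (map (λ t → mult t ys) ts)
                                                       ≡⟨ cong₂ _+_ (sum-mult-singleton y ts! y∈) (sum-mult ys ts! ys∈) ⟩
    suc (length ys) ∎
    where open ≡-Reasoning

  sum-map-split : ∀ (f : A → ℕ) {t ts} → Unique ts → t ∈ ts →
                  sum (map f ts) ≡ f t + sum (map f (filter (λ s → ¬? (s ≟ t)) ts))
  sum-map-split f {t} (t≢ ∷ _) (here refl) = cong (λ ss → f t + sum (map f ss))
    (sym (trans (filter-reject (λ s → ¬? (s ≟ t)) (λ t≢t → t≢t refl))
                (filter-all (λ s → ¬? (s ≟ t)) (All.map (λ t≢s s≡t → t≢s (sym s≡t)) t≢))))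
  sum-map-split f {t} {s ∷ ts} (s≢ ∷ ts!) (there t∈) = begin
    f s + sum (map f ts)                                    ≡⟨ cong (f s +_) (sum-map-split f ts! t∈) ⟩
    f s + (f t + sum (map f (filter (λ s → ¬? (s ≟ t)) ts)))  ≡⟨ x∙yz≈y∙xz (f s) (f t) _ ⟩
    f t + (f s + sum (map f (filter (λ s → ¬? (s ≟ t)) ts)))  ≡⟨ cong (λ ss → f t + sum (map f ss))
                                                                  (sym (filter-accept (λ s → ¬? (s ≟ t)) (All.lookup s≢ t∈))) ⟩
    f t + sum (map f (filter (λ s → ¬? (s ≟ t)) (s ∷ ts))) ∎
    where open ≡-Reasoning

  mult+mult≤length : ∀ {s t} xs → s ≢ t → mult s xs + mult t xs ≤ length xs
  mult+mult≤length [] s≢t = z≤n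
  mult+mult≤length {s} {t} (x ∷ xs) s≢t with x ≟ s | x ≟ t
  ... | yes refl | yes refl = contradiction refl s≢t
  ... | yes _    | no _     = s≤s (mult+mult≤length xs s≢t)
  ... | no _     | yes _    = ≤-trans (≤-reflexive (+-suc (mult s xs) (mult t xs))) (s≤s (mult+mult≤length xs s≢t))
  ... | no _     | no _     = m≤n⇒m≤1+n (mult+mult≤length xs s≢t)

  remove : A → List A → List A
  remove t [] = []
  remove t (x ∷ xs) with x ≟ t
  ... | yes _ = xs
  ... | no _  = x ∷ remove t xs

  remove-↭ : ∀ {t xs} → t ∈ xs → xs ↭ t ∷ remove t xs
  remove-↭ {t} {x ∷ xs} t∈ with x ≟ t
  ... | yes refl = ↭-refl
  remove-↭ {t} {x ∷ xs} (here refl) | no x≢t = contradiction refl x≢t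
  remove-↭ {t} {x ∷ xs} (there t∈) | no _ = ↭-trans (↭-prep x (remove-↭ t∈)) (↭-swap x t ↭-refl)

  length-remove : ∀ {t xs} → t ∈ xs → suc (length (remove t xs)) ≡ length xs
  length-remove t∈ = sym (↭-length (remove-↭ t∈))

  mult-remove-self : ∀ {t xs} → t ∈ xs → suc (mult t (remove t xs)) ≡ mult t xs
  mult-remove-self {t} {xs} t∈ = trans (sym (cong length (filter-accept (_≟ t) refl))) (sym (mult-↭ t (remove-↭ t∈)))

  mult-remove-other : ∀ {t s xs} → t ∈ xs → t ≢ s → mult s (remove t xs) ≡ mult s xs
  mult-remove-other {t} {s} t∈ t≢s = trans (sym (cong length (filter-reject (_≟ s) t≢s))) (sym (mult-↭ s (remove-↭ t∈)))

  mult-remove-≤ : ∀ {t xs} s → t ∈ xs → mult s (remove t xs) ≤ mult s xs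
  mult-remove-≤ {t} s t∈ with t ≟ s
  ... | yes refl = ≤-trans (n≤1+n _) (≤-reflexive (mult-remove-self t∈))
  ... | no t≢s = ≤-reflexive (mult-remove-other t∈ t≢s)

  mostFrequent : ∀ x xs → ∃ λ i → i ∈ x ∷ xs × ∀ t → mult t (x ∷ xs) ≤ mult i (x ∷ xs)
  mostFrequent x xs = i , i∈ , maximal
    where
    f : A → ℕ
    f t = mult t (x ∷ xs)
    i = argmax f x xs
    i∈ : i ∈ x ∷ xs
    i∈ = argmax-all f (here refl) (All.tabulate there)
    maximal : ∀ t → f t ≤ f i
    maximal t with t ∈? x ∷ xs
    ... | yes t∈ = All.lookup (f[⊥]≤f[argmax] {f = f} x xs ∷ f[xs]≤f[argmax] {f = f} x xs) t∈
    ... | no t∉ = ≤-trans (≤-reflexive (mult-∉ t∉)) z≤n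

  mult<length⇒∃≢ : ∀ {i xs} → mult i xs < length xs → ∃ λ j → j ∈ xs × j ≢ i
  mult<length⇒∃≢ {i} {xs} mult< with All.all? (_≟ i) xs
  ... | yes all≡ = contradiction (mult-All≡ all≡) (<⇒≢ mult<)
  ... | no ¬all≡ = find (All.¬All⇒Any¬ (_≟ i) xs ¬all≡)

  mult-remove-mostFrequent : ∀ {i xs} p q → i ∈ xs → (∀ t → mult t xs ≤ mult i xs) →
    length xs ≡ p + suc q → mult i xs ≤ suc (p ⊔ q) → ∀ t → mult t (remove i xs) ≤ p ⊔ q
  mult-remove-mostFrequent {i} {xs} p q i∈ maximal len i≤ t with i ≟ t
  ... | yes refl = ≤-pred (≤-trans (≤-reflexive (mult-remove-self i∈)) i≤)
  ... | no i≢t = ≤-trans (≤-reflexive (mult-remove-other i∈ i≢t))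
    (m≤n∧m+n≤o+1+p⇒m≤o⊔p (maximal t) (≤-trans (mult+mult≤length xs (i≢t ∘ sym)) (≤-reflexive len)))

  -- Removing a most frequent element meets both bounds below; removing any other element
  -- meets whichever of them equals suc a ⊔ suc b.
  pascal-removals : ∀ a b {ys} → length ys ≡ suc a + suc b → (∀ t → mult t ys ≤ suc a ⊔ suc b) →
    ∃ λ i → ∃ λ j → i ∈ ys × j ∈ ys × i ≢ j ×
      (∀ t → mult t (remove i ys) ≤ a ⊔ suc b) × (∀ t → mult t (remove j ys) ≤ suc a ⊔ b)
  pascal-removals a b {[]} ()
  pascal-removals a b {ys@(x ∷ xs)} len bound = choose (≤-total b a)
    where
    mf = mostFrequent x xs
    i = proj₁ mf
    i∈ = proj₁ (proj₂ mf)
    i-left : ∀ t → mult t (remove i ys) ≤ a ⊔ suc b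
    i-left = mult-remove-mostFrequent a (suc b) i∈ (proj₂ (proj₂ mf))
      (trans len (sym (+-suc a (suc b)))) (≤-trans (bound i) (s≤s (⊔-monoʳ-≤ a (n≤1+n b))))
    i-right : ∀ t → mult t (remove i ys) ≤ suc a ⊔ b
    i-right t = ≤-trans (mult-remove-mostFrequent b (suc a) i∈ (proj₂ (proj₂ mf))
      (trans len (trans (+-comm (suc a) (suc b)) (sym (+-suc b (suc a)))))
      (≤-trans (bound i) (s≤s (≤-trans (≤-reflexive (⊔-comm a b)) (⊔-monoʳ-≤ b (n≤1+n a))))) t)
      (≤-reflexive (⊔-comm b (suc a)))

    other = mult<length⇒∃≢ {i} {ys}
      (≤-trans (s≤s (≤-trans (bound i) (s≤s (m⊔n≤m+n a b))))
               (≤-reflexive (trans (cong suc (sym (+-suc a b))) (sym len))))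
    j = proj₁ other
    j∈ = proj₁ (proj₂ other)
    j≢i = proj₂ (proj₂ other)
    j-any : ∀ {c} → suc a ⊔ suc b ≤ c → ∀ t → mult t (remove j ys) ≤ c
    j-any ≤c t = ≤-trans (mult-remove-≤ t j∈) (≤-trans (bound t) ≤c)

    choose : b ≤ a ⊎ a ≤ b → ∃ λ i → ∃ λ j → i ∈ ys × j ∈ ys × i ≢ j ×
               (∀ t → mult t (remove i ys) ≤ a ⊔ suc b) × (∀ t → mult t (remove j ys) ≤ suc a ⊔ b)
    choose (inj₁ b≤a) = i , j , i∈ , j∈ , j≢i ∘ sym , i-left ,
      j-any (⊔-lub (m≤m⊔n (suc a) b) (≤-trans (s≤s b≤a) (m≤m⊔n (suc a) b)))
    choose (inj₂ a≤b) = j , i , j∈ , i∈ , j≢i ,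
      j-any (⊔-lub (≤-trans (s≤s a≤b) (m≤n⊔m a (suc b))) (m≤n⊔m a (suc b))) , i-right

  rearrangements : (n : ℕ) → List A → List (Vec A n)
  extensions : (n : ℕ) → List A → A → List (Vec A (suc n))

  rearrangements zero xs = [ []ᵥ ]
  rearrangements (suc n) xs = concatMap (extensions n xs) (deduplicate _≟_ xs)

  extensions n xs t = map (t ∷ᵥ_) (rearrangements n (remove t xs))

  extensions-⊆ : ∀ n {xs t} → t ∈ xs → extensions n xs t ⊆ rearrangements (suc n) xs
  extensions-⊆ n {xs} t∈ v∈ = ∈-concatMap⁺ (extensions n xs) (lose (∈-deduplicate⁺ _≟_ t∈) v∈)

  ∈-rearrangements⇒↭ : ∀ n {xs w} → length xs ≡ n → w ∈ rearrangements n xs → toList w ↭ xs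
  ∈-rearrangements⇒↭ zero {[]} _ (here refl) = ↭-refl
  ∈-rearrangements⇒↭ (suc n) {xs} len w∈
    with find (∈-concatMap⁻ (extensions n xs) {xs = deduplicate _≟_ xs} w∈)
  ... | t , t∈dedup , w∈ext with ∈-map⁻ (t ∷ᵥ_) w∈ext
  ... | w , w∈ , refl = ↭-trans (↭-prep t (∈-rearrangements⇒↭ n n≡ w∈)) (↭-sym (remove-↭ t∈))
    where
    t∈ = ∈-deduplicate⁻ _≟_ xs t∈dedup
    n≡ = suc-injective (trans (length-remove t∈) len)

  rearrangements-inhabited : ∀ n {xs} → length xs ≡ n → ∃ λ w → w ∈ rearrangements n xs
  rearrangements-inhabited zero _ = []ᵥ , here refl
  rearrangements-inhabited (suc n) {x ∷ xs} len
    with rearrangements-inhabited n (suc-injective (trans (length-remove (here refl)) len))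
  ... | w , w∈ = x ∷ᵥ w , extensions-⊆ n (here refl) (∈-map⁺ (x ∷ᵥ_) w∈)

  rearrangements-unique : ∀ n xs → Unique (rearrangements n xs)
  extensions-unique : ∀ n xs t → Unique (extensions n xs t)

  extensions-disjoint : ∀ n xs {s t} → s ≢ t → Disjoint (extensions n xs s) (extensions n xs t)
  extensions-disjoint n xs s≢t (v∈s , v∈t) with ∈-map⁻ _ v∈s | ∈-map⁻ _ v∈t
  ... | _ , _ , refl | _ , _ , same = s≢t (∷-injectiveˡ same)

  rearrangements-unique zero xs = [] ∷ []
  rearrangements-unique (suc n) xs = Unique.concat⁺
    (All.map⁺ (All.universal (extensions-unique n xs) _))
    (AllPairs.map⁺ (AllPairs.map (extensions-disjoint n xs) (deduplicate-! xs)))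

  extensions-unique n xs t = Unique.map⁺ ∷-injectiveʳ (rearrangements-unique n (remove t xs))

  length-rearrangements-step : ∀ n {xs s t} → s ∈ xs → t ∈ xs → s ≢ t →
    length (rearrangements n (remove s xs)) + length (rearrangements n (remove t xs))
      ≤ length (rearrangements (suc n) xs)
  length-rearrangements-step n {xs} {s} {t} s∈ t∈ s≢t = begin
    length (rearrangements n (remove s xs)) + length (rearrangements n (remove t xs))
      ≡⟨ sym (cong₂ _+_ (length-map (s ∷ᵥ_) (rearrangements n (remove s xs)))
                        (length-map (t ∷ᵥ_) (rearrangements n (remove t xs)))) ⟩
    length (extensions n xs s) + length (extensions n xs t)
      ≡⟨ sym (length-++ (extensions n xs s)) ⟩
    length (extensions n xs s ++ extensions n xs t)
      ≤⟨ Unique-⊆⇒length-≤ both-unique both-⊆ ⟩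
    length (rearrangements (suc n) xs) ∎
    where
    open ≤-Reasoning
    both-unique = Unique.++⁺ (extensions-unique n xs s) (extensions-unique n xs t) (extensions-disjoint n xs s≢t)
    both-⊆ : extensions n xs s ++ extensions n xs t ⊆ rearrangements (suc n) xs
    both-⊆ = [ extensions-⊆ n s∈ , extensions-⊆ n t∈ ]′ ∘ ∈-++⁻ (extensions n xs s)

  binomial≤length-rearrangements : ∀ n a b {xs} → a + b ≡ n → length xs ≡ n → (∀ t → mult t xs ≤ a ⊔ b) →
                                   n C a ≤ length (rearrangements n xs)
  binomial≤length-rearrangements n zero b _ len _ = ∈⇒1≤length (proj₂ (rearrangements-inhabited n len))
  binomial≤length-rearrangements n (suc a) zero e len _ = begin
    n C suc a          ≡⟨ cong (_C suc a) (trans (sym e) (+-identityʳ (suc a))) ⟩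
    suc a C suc a      ≡⟨ nCn≡1 (suc a) ⟩
    1                  ≤⟨ ∈⇒1≤length (proj₂ (rearrangements-inhabited n len)) ⟩
    length (rearrangements n _) ∎
    where open ≤-Reasoning
  binomial≤length-rearrangements zero (suc a) (suc b) () _ _
  binomial≤length-rearrangements (suc n) (suc a) (suc b) {ys} e len bound
    with pascal-removals a b (trans len (sym e)) bound
  ... | i , j , i∈ , j∈ , i≢j , i-bound , j-bound = begin
    suc n C suc a
      ≡⟨ sym (nCk+nC[k+1]≡[n+1]C[k+1] n a) ⟩
    n C a + n C suc a
      ≤⟨ +-mono-≤ (binomial≤length-rearrangements n a (suc b) n≡ (length-remove′ i∈) i-bound)
                  (binomial≤length-rearrangements n (suc a) b (trans (sym (+-suc a b)) n≡) (length-remove′ j∈) j-bound) ⟩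
    length (rearrangements n (remove i ys)) + length (rearrangements n (remove j ys))
      ≤⟨ length-rearrangements-step n i∈ j∈ i≢j ⟩
    length (rearrangements (suc n) ys) ∎
    where
    open ≤-Reasoning
    n≡ : a + suc b ≡ n
    n≡ = suc-injective e
    length-remove′ : ∀ {t} → t ∈ ys → length (remove t ys) ≡ n
    length-remove′ t∈ = suc-injective (trans (length-remove t∈) len)

-- Counting the points of a predicate on Fin n

vector-covering : ∀ {A : Set} (a : A) xs {c} → length xs ≤ c →
                  ∃ λ (v : Vec A c) → ∀ {x} → x ∈ xs → ∃ λ i → lookup v i ≡ x
vector-covering a [] {c} _ = replicate c a , λ ()
vector-covering a (x ∷ xs) (s≤s le) = let (v , covers) = vector-covering a xs le in
  x ∷ᵥ v , λ { (here refl) → zero , refl ; (there x∈) → let (i , lookup≡) = covers x∈ in suc i , lookup≡ }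

module Counting {n} {P : Fin n → Set} (P? : Decidable P) where

  ∣P∣ : ℕ
  ∣P∣ = length (filter P? (allFin n))

  covered⇒count≤ : ∀ {c} (σ : Fin c → Fin n) → (∀ x → P x → ∃ λ i → σ i ≡ x) → ∣P∣ ≤ c
  covered⇒count≤ σ covers =
    ≤-trans (Unique-⊆⇒length-≤ (Unique.filter⁺ P? (Unique.allFin⁺ n)) ⊆image) (≤-reflexive (length-tabulate σ))
    where
    ⊆image : filter P? (allFin n) ⊆ List.tabulate σ
    ⊆image x∈ with covers _ (proj₂ (∈-filter⁻ P? {xs = allFin n} x∈))
    ... | i , refl = ∈-tabulate⁺ i

  count≤⇒covered : ∀ {c} → Fin n → ∣P∣ ≤ c → ∃ λ (σ : Fin c → Fin n) → ∀ x → P x → ∃ λ i → σ i ≡ x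
  count≤⇒covered a count≤ = let (v , covers) = vector-covering a (filter P? (allFin n)) count≤ in
    lookup v , λ x px → covers (∈-filter⁺ P? (∈-allFin x) px)

  escapes⇔ : ∀ {j} → Fin n → (∀ (σ : Fin j → Fin n) → ∃ λ x → (∀ i → σ i ≢ x) × P x) ⇔ j < ∣P∣
  escapes⇔ {j} a = mk⇔ to′ from′
    where
    to′ : (∀ (σ : Fin j → Fin n) → ∃ λ x → (∀ i → σ i ≢ x) × P x) → j < ∣P∣
    to′ escape = ≰⇒> λ count≤ →
      let (σ , covers) = count≤⇒covered a count≤
          (x , avoids , px) = escape σ
          (i , σi≡x) = covers x px
      in avoids i σi≡x
    from′ : j < ∣P∣ → ∀ (σ : Fin j → Fin n) → ∃ λ x → (∀ i → σ i ≢ x) × P x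
    from′ j<count σ with any? (λ x → ¬? (any? (λ i → σ i ≟F x)) ×-dec P? x)
    ... | yes (x , uncovered , px) = x , (λ i σi≡x → uncovered (i , σi≡x)) , px
    ... | no none = contradiction (covered⇒count≤ σ covers) (<⇒≱ j<count)
      where
      covers : ∀ x → P x → ∃ λ i → σ i ≡ x
      covers x px = decidable-stable (any? (λ i → σ i ≟F x)) (λ uncovered → none (x , uncovered , px))

  covers⇔ : ∀ {c} → Fin n → (∃ λ (σ : Fin c → Fin n) → ∀ x → (∃ λ i → σ i ≡ x) ⊎ ¬ P x) ⇔ ∣P∣ ≤ c
  covers⇔ a = mk⇔
    (λ (σ , covers) → covered⇒count≤ σ (λ x px → [ id , (λ ¬px → contradiction px ¬px) ]′ (covers x)))
    (λ count≤ → let (σ , covers) = count≤⇒covered a count≤ in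
      σ , λ x → [ (λ px → inj₁ (covers x px)) , inj₂ ]′ (toSum (P? x)))

-- Enumerations, models and point types

allVecs-suc : ∀ {A : Set} (xs : List A) k →
  allVecs xs (suc k) ≡ cartesianProductWith _∷ᵥ_ xs (allVecs xs k)
allVecs-suc xs k = go xs
  where
  go : ∀ ys → concatMap (λ y → map (y ∷ᵥ_) (allVecs xs k)) ys ≡ cartesianProductWith _∷ᵥ_ ys (allVecs xs k)
  go [] = refl
  go (y ∷ ys) = cong (map (y ∷ᵥ_) (allVecs xs k) ++_) (go ys)

length-cartesianProductWith : ∀ {A B C : Set} (f : A → B → C) xs ys →
  length (cartesianProductWith f xs ys) ≡ length xs * length ys
length-cartesianProductWith f [] ys = refl
length-cartesianProductWith f (x ∷ xs) ys =
  trans (length-++ (map (f x) ys)) (cong₂ _+_ (length-map (f x) ys) (length-cartesianProductWith f xs ys))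

∈-allVecs : ∀ {A : Set} {xs : List A} → (∀ x → x ∈ xs) → ∀ {k} (v : Vec A k) → v ∈ allVecs xs k
∈-allVecs xs-complete []ᵥ = here refl
∈-allVecs {xs = xs} xs-complete {suc k} (x ∷ᵥ v) rewrite allVecs-suc xs k =
  ∈-cartesianProductWith⁺ _∷ᵥ_ (xs-complete x) (∈-allVecs xs-complete v)

allVecs-unique : ∀ {A : Set} {xs : List A} → Unique xs → ∀ k → Unique (allVecs xs k)
allVecs-unique xs! zero = [] ∷ []
allVecs-unique {xs = xs} xs! (suc k) rewrite allVecs-suc xs k =
  Unique.cartesianProductWith⁺ _∷ᵥ_ ∷-injective xs! (allVecs-unique xs! k)

length-allVecs : ∀ {A : Set} (xs : List A) k → length (allVecs xs k) ≡ length xs ^ k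
length-allVecs xs zero = refl
length-allVecs xs (suc k) rewrite allVecs-suc xs k =
  trans (length-cartesianProductWith _∷ᵥ_ xs (allVecs xs k)) (cong (length xs *_) (length-allVecs xs k))

∈-allSubsets : ∀ {k} (π : Subset k) → π ∈ allSubsets k
∈-allSubsets = ∈-allVecs λ { true → here refl ; false → there (here refl) }

allSubsets-unique : ∀ k → Unique (allSubsets k)
allSubsets-unique = allVecs-unique (((λ ()) ∷ []) ∷ [] ∷ [])

length-allSubsets : ∀ k → length (allSubsets k) ≡ 2 ^ k
length-allSubsets = length-allVecs (inside ∷ outside ∷ [])

∈-allModels : ∀ {k n} (M : Model k n) → M ∈ allModels k n
∈-allModels = ∈-allVecs ∈-allSubsets

_≟ᵀ_ : ∀ {k} → DecidableEquality (Type k)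
_≟ᵀ_ = ≡-dec _≟B_

open module TypeMultiplicity {k} = Multiplicity (_≟ᵀ_ {k})

pointTypes : ∀ {k n} → Model k n → List (Type k)
pointTypes {n = n} M = map (pointType M) (allFin n)

length-pointTypes : ∀ {k n} (M : Model k n) → length (pointTypes M) ≡ n
length-pointTypes {n = n} M = trans (length-map (pointType M) (allFin n)) (length-tabulate (λ i → i))

count≡mult : ∀ {k n} (M : Model k n) π → count M π ≡ mult π (pointTypes M)
count≡mult {n = n} M π = sym (length-filter-map (_≟ᵀ π) (pointType M) (allFin n))

↭⇒≡[_] : ∀ {k n} d {M M′ : Model k n} → pointTypes M ↭ pointTypes M′ → M ≡[ d ] M′
↭⇒≡[ d ] {M} {M′} p π _ = trans (count≡mult M π) (trans (mult-↭ π p) (sym (count≡mult M′ π)))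

pointType≡⇔ : ∀ {k n} (M : Model k n) i π → pointType M i ≡ π ⇔ (∀ r → lookup (lookup M r) i ≡ lookup π r)
pointType≡⇔ M i π = mk⇔
  (λ { refl r → sym (lookup-map r (λ S → lookup S i) M) })
  (λ agree → trans (sym (tabulate∘lookup (pointType M i)))
                   (trans (tabulate-cong (λ r → trans (lookup-map r _ M) (agree r))) (tabulate∘lookup π)))

toModel : ∀ {k n} → Vec (Type k) n → Model k n
toModel w = tabulate (λ r → tabulate (λ i → lookup (lookup w i) r))

pointType-toModel : ∀ {k n} (w : Vec (Type k) n) i → pointType (toModel w) i ≡ lookup w i
pointType-toModel w i = Equivalence.from (pointType≡⇔ (toModel w) i (lookup w i))
  (λ r → trans (cong (λ S → lookup S i) (lookup∘tabulate _ r)) (lookup∘tabulate _ i))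

toModel-injective : ∀ {k n} {w w′ : Vec (Type k) n} → toModel w ≡ toModel w′ → w ≡ w′
toModel-injective {w = w} {w′} same-model =
  trans (sym (tabulate∘lookup w)) (trans (tabulate-cong same-point) (tabulate∘lookup w′))
  where
  same-point : ∀ i → lookup w i ≡ lookup w′ i
  same-point i = trans (sym (pointType-toModel w i)) (trans (cong (λ M → pointType M i) same-model) (pointType-toModel w′ i))

tabulate-lookup : ∀ {A : Set} {n} (w : Vec A n) → List.tabulate (lookup w) ≡ toList w
tabulate-lookup []ᵥ = refl
tabulate-lookup (x ∷ᵥ w) = cong (x ∷_) (tabulate-lookup w)

pointTypes-toModel : ∀ {k n} (w : Vec (Type k) n) → pointTypes (toModel w) ≡ toList w
pointTypes-toModel {n = n} w = trans (map-cong (pointType-toModel w) (allFin n))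
                                     (trans (map-tabulate (λ i → i) (lookup w)) (tabulate-lookup w))

binomial≤classSize : ∀ {k n} d (M : Model k n) h → h ≤ n → (∀ π → count M π ≤ n ∸ h) → n C h ≤ classSize d M
binomial≤classSize {k} {n} d M h h≤n small = begin
  n C h
    ≤⟨ binomial≤length-rearrangements n h (n ∸ h) (m+[n∸m]≡n h≤n) (length-pointTypes M) mult≤ ⟩
  length (rearrangements n (pointTypes M))
    ≡⟨ sym (length-map toModel (rearrangements n (pointTypes M))) ⟩
  length (map toModel (rearrangements n (pointTypes M)))
    ≤⟨ Unique-⊆⇒length-≤ (Unique.map⁺ toModel-injective (rearrangements-unique n _)) ⊆class ⟩
  classSize d M ∎
  where
  open ≤-Reasoning
  mult≤ : ∀ π → mult π (pointTypes M) ≤ h ⊔ (n ∸ h)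
  mult≤ π = ≤-trans (≤-reflexive (sym (count≡mult M π))) (≤-trans (small π) (m≤n⊔m h (n ∸ h)))
  ⊆class : map toModel (rearrangements n (pointTypes M)) ⊆ filter (≡d? d M) (allModels k n)
  ⊆class v∈ with ∈-map⁻ toModel v∈
  ... | w , w∈ , refl = ∈-filter⁺ (≡d? d M) (∈-allModels (toModel w))
    (↭⇒≡[ d ] (↭-sym (subst (_↭ pointTypes M) (sym (pointTypes-toModel w))
                            (∈-rearrangements⇒↭ n (length-pointTypes M) w∈))))

otherTypes : ∀ {k} → Type k → List (Type k)
otherTypes {k} π₀ = filter (λ π → ¬? (π ≟ᵀ π₀)) (allSubsets k)

length-otherTypes : ∀ {k} (π₀ : Type k) → length (otherTypes π₀) ≤ 2 ^ k
length-otherTypes {k} π₀ =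
  ≤-trans (length-filter (λ π → ¬? (π ≟ᵀ π₀)) (allSubsets k)) (≤-reflexive (length-allSubsets k))

count+sum-otherTypes : ∀ {k n} (M : Model k n) π₀ → count M π₀ + sum (map (count M) (otherTypes π₀)) ≡ n
count+sum-otherTypes {k} {n} M π₀ = begin
  count M π₀ + sum (map (count M) (otherTypes π₀))
    ≡⟨ sym (sum-map-split (count M) (allSubsets-unique k) (∈-allSubsets π₀)) ⟩
  sum (map (count M) (allSubsets k))
    ≡⟨ cong sum (map-cong (count≡mult M) (allSubsets k)) ⟩
  sum (map (λ π → mult π (pointTypes M)) (allSubsets k))
    ≡⟨ sum-mult (pointTypes M) (allSubsets-unique k) (All.universal ∈-allSubsets (pointTypes M)) ⟩
  length (pointTypes M)
    ≡⟨ length-pointTypes M ⟩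
  n ∎
  where open ≡-Reasoning

-- Formulas

extend-cong : ∀ {n m} {ρ σ : Fin m → Fin n} → ρ ≗ σ → ∀ a → extend ρ a ≗ extend σ a
extend-cong ρ≗σ a zero = refl
extend-cong ρ≗σ a (suc x) = ρ≗σ x

extend-head-tail : ∀ {n m} (σ : Fin (suc m) → Fin n) → extend (σ ∘ suc) (σ zero) ≗ σ
extend-head-tail σ zero = refl
extend-head-tail σ (suc x) = refl

Sat-cong : ∀ {k n m} (M : Model k n) {ρ σ : Fin m → Fin n} → ρ ≗ σ → ∀ φ → Sat M ρ φ → Sat M σ φ
Sat-cong M ρ≗σ (rel r x) s = subst (λ a → lookup (lookup M r) a ≡ true) (ρ≗σ x) s
Sat-cong M ρ≗σ (nrel r x) s = s ∘ subst (λ a → lookup (lookup M r) a ≡ true) (sym (ρ≗σ x))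
Sat-cong M ρ≗σ (eq x y) s = trans (sym (ρ≗σ x)) (trans s (ρ≗σ y))
Sat-cong M ρ≗σ (neq x y) s = λ σx≡σy → s (trans (ρ≗σ x) (trans σx≡σy (sym (ρ≗σ y))))
Sat-cong M ρ≗σ (φ ∧ᶠ ψ) (s , t) = Sat-cong M ρ≗σ φ s , Sat-cong M ρ≗σ ψ t
Sat-cong M ρ≗σ (φ ∨ᶠ ψ) = Sum.map (Sat-cong M ρ≗σ φ) (Sat-cong M ρ≗σ ψ)
Sat-cong M ρ≗σ (all φ) s a = Sat-cong M (extend-cong ρ≗σ a) φ (s a)
Sat-cong M ρ≗σ (ex φ) (a , s) = a , Sat-cong M (extend-cong ρ≗σ a) φ s

∃⋯ : ∀ {k} j → Formula k j → Sentence k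
∃⋯ zero φ = φ
∃⋯ (suc j) φ = ∃⋯ j (ex φ)

∀⋯ : ∀ {k} j → Formula k j → Sentence k
∀⋯ zero φ = φ
∀⋯ (suc j) φ = ∀⋯ j (all φ)

Sat-∃⋯ : ∀ {k n} (M : Model k n) j (φ : Formula k j) {ρ : Fin 0 → Fin n} →
         Sat M ρ (∃⋯ j φ) ⇔ (∃ λ σ → Sat M σ φ)
Sat-∃⋯ M zero φ {ρ} = mk⇔ (ρ ,_) (λ (σ , s) → Sat-cong M (λ ()) φ s)
Sat-∃⋯ M (suc j) φ = ⇔-trans (Sat-∃⋯ M j (ex φ)) (mk⇔
  (λ (σ , a , s) → extend σ a , s)
  (λ (τ , s) → τ ∘ suc , τ zero , Sat-cong M (sym ∘ extend-head-tail τ) φ s))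

Sat-∀⋯ : ∀ {k n} (M : Model k n) j (φ : Formula k j) {ρ : Fin 0 → Fin n} →
         Sat M ρ (∀⋯ j φ) ⇔ (∀ σ → Sat M σ φ)
Sat-∀⋯ M zero φ {ρ} = mk⇔ (λ s σ → Sat-cong M (λ ()) φ s) (λ s → s ρ)
Sat-∀⋯ M (suc j) φ = ⇔-trans (Sat-∀⋯ M j (all φ)) (mk⇔
  (λ s τ → Sat-cong M (extend-head-tail τ) φ (s (τ ∘ suc) (τ zero)))
  (λ s σ a → s (extend σ a)))

qr-∃⋯ : ∀ {k} j (φ : Formula k j) → qr (∃⋯ j φ) ≡ j + qr φ
qr-∃⋯ zero φ = refl
qr-∃⋯ (suc j) φ = trans (qr-∃⋯ j (ex φ)) (+-suc j (qr φ))

qr-∀⋯ : ∀ {k} j (φ : Formula k j) → qr (∀⋯ j φ) ≡ j + qr φ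
qr-∀⋯ zero φ = refl
qr-∀⋯ (suc j) φ = trans (qr-∀⋯ j (all φ)) (+-suc j (qr φ))

size-∃⋯ : ∀ {k} j (φ : Formula k j) → size (∃⋯ j φ) ≡ j + size φ
size-∃⋯ zero φ = refl
size-∃⋯ (suc j) φ = trans (size-∃⋯ j (ex φ)) (+-suc j (size φ))

size-∀⋯ : ∀ {k} j (φ : Formula k j) → size (∀⋯ j φ) ≡ j + size φ
size-∀⋯ zero φ = refl
size-∀⋯ (suc j) φ = trans (size-∀⋯ j (all φ)) (+-suc j (size φ))

lit : ∀ {k m} → Bool → Fin k → Fin m → Formula k m
lit true = rel
lit false = nrel

Sat-lit : ∀ {k n m} (M : Model k n) (ρ : Fin m → Fin n) b r x →
          Sat M ρ (lit b r x) ⇔ lookup (lookup M r) (ρ x) ≡ b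
Sat-lit M ρ true r x = mk⇔ id id
Sat-lit M ρ false r x = mk⇔ ¬-not not-¬

size-lit : ∀ {k m} b (r : Fin k) (x : Fin m) → size (lit b r x) ≡ 1
size-lit true r x = refl
size-lit false r x = refl

qr-lit : ∀ {k m} b (r : Fin k) (x : Fin m) → qr (lit b r x) ≤ 0
qr-lit true r x = z≤n
qr-lit false r x = z≤n

⋀ : ∀ {k m} → List (Formula k m) → Formula k m → Formula k m
⋀ ψs φ = foldr _∧ᶠ_ φ ψs

⋁ : ∀ {k m} → List (Formula k m) → Formula k m → Formula k m
⋁ ψs φ = foldr _∨ᶠ_ φ ψs

module _ {k n m} (M : Model k n) (ρ : Fin m → Fin n) where

  Sat-⋀ : ∀ ψs φ → Sat M ρ (⋀ ψs φ) ⇔ (All (Sat M ρ) ψs × Sat M ρ φ)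
  Sat-⋀ [] φ = mk⇔ ([] ,_) proj₂
  Sat-⋀ (ψ ∷ ψs) φ = mk⇔
    (λ (s , rest) → let (ss , t) = to (Sat-⋀ ψs φ) rest in s ∷ ss , t)
    (λ { (s ∷ ss , t) → s , from (Sat-⋀ ψs φ) (ss , t) })

  Sat-⋁ : ∀ ψs φ → Sat M ρ (⋁ ψs φ) ⇔ (Any (Sat M ρ) ψs ⊎ Sat M ρ φ)
  Sat-⋁ [] φ = mk⇔ inj₂ [ (λ ()) , id ]′
  Sat-⋁ (ψ ∷ ψs) φ = mk⇔
    (λ { (inj₁ s) → inj₁ (here s) ; (inj₂ rest) → Sum.map₁ there (to (Sat-⋁ ψs φ) rest) })
    (λ { (inj₁ (here s)) → inj₁ s
       ; (inj₁ (there ss)) → inj₂ (from (Sat-⋁ ψs φ) (inj₁ ss))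
       ; (inj₂ t) → inj₂ (from (Sat-⋁ ψs φ) (inj₂ t)) })

size-⋀ : ∀ {k m s} {ψs : List (Formula k m)} φ → All (λ ψ → size ψ ≡ s) ψs →
         size (⋀ ψs φ) ≡ length ψs * suc s + size φ
size-⋀ φ [] = refl
size-⋀ {s = s} φ (size≡ ∷ sizes≡) =
  cong suc (trans (cong₂ _+_ size≡ (size-⋀ φ sizes≡)) (sym (+-assoc s _ (size φ))))

size-⋁ : ∀ {k m s} {ψs : List (Formula k m)} φ → All (λ ψ → size ψ ≡ s) ψs →
         size (⋁ ψs φ) ≡ length ψs * suc s + size φ
size-⋁ φ [] = refl
size-⋁ {s = s} φ (size≡ ∷ sizes≡) =
  cong suc (trans (cong₂ _+_ size≡ (size-⋁ φ sizes≡)) (sym (+-assoc s _ (size φ))))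

qr-⋀ : ∀ {k m q} {ψs : List (Formula k m)} {φ} → All (λ ψ → qr ψ ≤ q) ψs → qr φ ≤ q → qr (⋀ ψs φ) ≤ q
qr-⋀ [] qrφ≤ = qrφ≤
qr-⋀ (qrψ≤ ∷ qrψs≤) qrφ≤ = ⊔-lub qrψ≤ (qr-⋀ qrψs≤ qrφ≤)

qr-⋁ : ∀ {k m q} {ψs : List (Formula k m)} {φ} → All (λ ψ → qr ψ ≤ q) ψs → qr φ ≤ q → qr (⋁ ψs φ) ≤ q
qr-⋁ [] qrφ≤ = qrφ≤
qr-⋁ (qrψ≤ ∷ qrψs≤) qrφ≤ = ⊔-lub qrψ≤ (qr-⋁ qrψs≤ qrφ≤)

-- eq x x and neq x x serve as the empty conjunction and the empty disjunction.
hasType : ∀ {k m} → Type k → Fin m → Formula k m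
hasType π x = ⋀ (List.tabulate (λ r → lit (lookup π r) r x)) (eq x x)

lacksType : ∀ {k m} → Type k → Fin m → Formula k m
lacksType π x = ⋁ (List.tabulate (λ r → lit (not (lookup π r)) r x)) (neq x x)

module _ {k n m} (M : Model k n) (ρ : Fin m → Fin n) (π : Type k) (x : Fin m) where

  Sat-hasType : Sat M ρ (hasType π x) ⇔ pointType M (ρ x) ≡ π
  Sat-hasType = mk⇔
    (λ s → from (pointType≡⇔ M (ρ x) π)
             (λ r → to (Sat-lit M ρ _ r x) (All.tabulate⁻ (proj₁ (to (Sat-⋀ M ρ _ _) s)) r)))
    (λ type≡ → from (Sat-⋀ M ρ _ _)
                 (All.tabulate⁺ (λ r → from (Sat-lit M ρ _ r x) (to (pointType≡⇔ M (ρ x) π) type≡ r)) , refl))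

  Sat-lacksType : Sat M ρ (lacksType π x) ⇔ pointType M (ρ x) ≢ π
  Sat-lacksType = mk⇔ to′ from′
    where
    to′ : Sat M ρ (lacksType π x) → pointType M (ρ x) ≢ π
    to′ s type≡ with to (Sat-⋁ M ρ _ _) s
    ... | inj₂ x≢x = x≢x refl
    ... | inj₁ some with Any.tabulate⁻ some
    ...   | r , differs = not-¬ (to (pointType≡⇔ M (ρ x) π) type≡ r) (to (Sat-lit M ρ _ r x) differs)
    from′ : pointType M (ρ x) ≢ π → Sat M ρ (lacksType π x)
    from′ type≢ = from (Sat-⋁ M ρ _ _) (inj₁ (Any.tabulate⁺ r (from (Sat-lit M ρ _ r x) (¬-not differs))))
      where
      witness = ¬∀⟶∃¬ k _ (λ r → lookup (lookup M r) (ρ x) ≟B lookup π r)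
                          (type≢ ∘ from (pointType≡⇔ M (ρ x) π))
      r = proj₁ witness
      differs = proj₂ witness

size-hasType : ∀ {k m} (π : Type k) (x : Fin m) → size (hasType π x) ≡ k * 2 + 1
size-hasType {k} π x = trans (size-⋀ (eq x x) (All.tabulate⁺ (λ r → size-lit (lookup π r) r x)))
                             (cong (λ l → l * 2 + 1) (length-tabulate (λ r → lit (lookup π r) r x)))

size-lacksType : ∀ {k m} (π : Type k) (x : Fin m) → size (lacksType π x) ≡ k * 2 + 1
size-lacksType {k} π x = trans (size-⋁ (neq x x) (All.tabulate⁺ (λ r → size-lit (not (lookup π r)) r x)))
                               (cong (λ l → l * 2 + 1) (length-tabulate (λ r → lit (not (lookup π r)) r x)))

qr-hasType : ∀ {k m} (π : Type k) (x : Fin m) → qr (hasType π x) ≤ 0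
qr-hasType π x = qr-⋀ (All.tabulate⁺ (λ r → qr-lit (lookup π r) r x)) z≤n

qr-lacksType : ∀ {k m} (π : Type k) (x : Fin m) → qr (lacksType π x) ≤ 0
qr-lacksType π x = qr-⋁ (All.tabulate⁺ (λ r → qr-lit (not (lookup π r)) r x)) z≤n

-- In a context of suc j variables, zero is the point x sought and suc i is the parameter yᵢ.
freshOfType : ∀ {k j} → Type k → Formula k (suc j)
freshOfType π = ⋀ (List.tabulate (λ i → neq (suc i) zero)) (hasType π zero)

listedOrLacksType : ∀ {k j} → Type k → Formula k (suc j)
listedOrLacksType π = ⋁ (List.tabulate (λ i → eq (suc i) zero)) (lacksType π zero)

module _ {k n j} (M : Model k n) (π : Type k) (σ : Fin j → Fin n) (x : Fin n) where

  Sat-freshOfType : Sat M (extend σ x) (freshOfType π) ⇔ ((∀ i → σ i ≢ x) × pointType M x ≡ π)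
  Sat-freshOfType = ⇔-trans (Sat-⋀ M (extend σ x) _ _) (All-tabulate⇔ ×-⇔ Sat-hasType M (extend σ x) π zero)

  Sat-listedOrLacksType : Sat M (extend σ x) (listedOrLacksType π) ⇔ ((∃ λ i → σ i ≡ x) ⊎ pointType M x ≢ π)
  Sat-listedOrLacksType = ⇔-trans (Sat-⋁ M (extend σ x) _ _) (Any-tabulate⇔ ⊎-⇔ Sat-lacksType M (extend σ x) π zero)

moreThan : ∀ {k} → ℕ → Type k → Sentence k
moreThan j π = ∀⋯ j (ex (freshOfType π))

atMost : ∀ {k} → ℕ → Type k → Sentence k
atMost c π = ∃⋯ c (all (listedOrLacksType π))

exactly : ∀ {k} → ℕ → Type k → Sentence k
exactly zero π = atMost zero π
exactly (suc j) π = moreThan j π ∧ᶠ atMost (suc j) π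

-- The point a is needed: over the empty domain, moreThan j π and atMost c π have the
-- wrong truth value once j, c > 0.
module _ {k n} (M : Model k n) (a : Fin n) (π : Type k) where
  open Counting (λ i → pointType M i ≟ᵀ π)

  ⊨-moreThan : ∀ j → M ⊨ moreThan j π ⇔ j < count M π
  ⊨-moreThan j = ⇔-trans (Sat-∀⋯ M j _) (⇔-trans (Π-⇔ λ σ → Σ-⇔ λ x → Sat-freshOfType M π σ x) (escapes⇔ a))

  ⊨-atMost : ∀ c → M ⊨ atMost c π ⇔ count M π ≤ c
  ⊨-atMost c =
    ⇔-trans (Sat-∃⋯ M c _) (⇔-trans (Σ-⇔ λ σ → Π-⇔ λ x → Sat-listedOrLacksType M π σ x) (covers⇔ a))

  ⊨-exactly : ∀ c → M ⊨ exactly c π ⇔ count M π ≡ c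
  ⊨-exactly zero = mk⇔ (n≤0⇒n≡0 ∘ to (⊨-atMost 0)) (from (⊨-atMost 0) ∘ ≤-reflexive)
  ⊨-exactly (suc j) = mk⇔
    (λ (more , atMost′) → ≤-antisym (to (⊨-atMost (suc j)) atMost′) (to (⊨-moreThan j) more))
    (λ count≡ → from (⊨-moreThan j) (≤-reflexive (sym count≡)) , from (⊨-atMost (suc j)) (≤-reflexive count≡))

size-freshOfType : ∀ {k j} (π : Type k) → size (freshOfType {j = j} π) ≡ j * 2 + (k * 2 + 1)
size-freshOfType {k} {j} π =
  trans (size-⋀ (hasType π zero) (All.tabulate⁺ {f = λ (i : Fin j) → neq {k} (suc i) zero} (λ _ → refl)))
        (cong₂ (λ l s → l * 2 + s) (length-tabulate (λ (i : Fin j) → neq {k} (suc i) zero)) (size-hasType π zero))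

size-listedOrLacksType : ∀ {k j} (π : Type k) → size (listedOrLacksType {j = j} π) ≡ j * 2 + (k * 2 + 1)
size-listedOrLacksType {k} {j} π =
  trans (size-⋁ (lacksType π zero) (All.tabulate⁺ {f = λ (i : Fin j) → eq {k} (suc i) zero} (λ _ → refl)))
        (cong₂ (λ l s → l * 2 + s) (length-tabulate (λ (i : Fin j) → eq {k} (suc i) zero)) (size-lacksType π zero))

size-moreThan : ∀ {k} j (π : Type k) → size (moreThan j π) ≡ 3 * j + 2 * k + 2
size-moreThan {k} j π = trans (size-∀⋯ j _) (trans (cong (λ s → j + suc s) (size-freshOfType π)) (arith j k))
  where
  arith : ∀ j k → j + suc (j * 2 + (k * 2 + 1)) ≡ 3 * j + 2 * k + 2
  arith = solve-∀

size-atMost : ∀ {k} c (π : Type k) → size (atMost c π) ≡ 3 * c + 2 * k + 2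
size-atMost {k} c π = trans (size-∃⋯ c _) (trans (cong (λ s → c + suc s) (size-listedOrLacksType π)) (arith c k))
  where
  arith : ∀ c k → c + suc (c * 2 + (k * 2 + 1)) ≡ 3 * c + 2 * k + 2
  arith = solve-∀

size-exactly : ∀ {k} c (π : Type k) → size (exactly c π) ≤ 6 * c + 4 * k + 2
size-exactly {k} zero π = ≤-trans (≤-reflexive (size-atMost 0 π)) (+-monoˡ-≤ 2 (*-monoˡ-≤ k {2} {4} (s≤s (s≤s z≤n))))
size-exactly {k} (suc j) π =
  ≤-reflexive (trans (cong₂ (λ s t → suc (s + t)) (size-moreThan j π) (size-atMost (suc j) π)) (arith j k))
  where
  arith : ∀ j k → suc (3 * j + 2 * k + 2 + (3 * suc j + 2 * k + 2)) ≡ 6 * suc j + 4 * k + 2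
  arith = solve-∀

qr-freshOfType : ∀ {k j} (π : Type k) → qr (freshOfType {j = j} π) ≤ 0
qr-freshOfType {k} {j} π =
  qr-⋀ {φ = hasType π zero} (All.tabulate⁺ {f = λ (i : Fin j) → neq {k} (suc i) zero} (λ _ → z≤n)) (qr-hasType π zero)

qr-listedOrLacksType : ∀ {k j} (π : Type k) → qr (listedOrLacksType {j = j} π) ≤ 0
qr-listedOrLacksType {k} {j} π =
  qr-⋁ {φ = lacksType π zero} (All.tabulate⁺ {f = λ (i : Fin j) → eq {k} (suc i) zero} (λ _ → z≤n)) (qr-lacksType π zero)

qr-moreThan : ∀ {k} j (π : Type k) → qr (moreThan j π) ≤ j + 1
qr-moreThan j π = ≤-trans (≤-reflexive (qr-∀⋯ j _)) (+-monoʳ-≤ j (s≤s (qr-freshOfType {j = j} π)))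

qr-atMost : ∀ {k} c (π : Type k) → qr (atMost c π) ≤ c + 1
qr-atMost c π = ≤-trans (≤-reflexive (qr-∃⋯ c _)) (+-monoʳ-≤ c (s≤s (qr-listedOrLacksType {j = c} π)))

qr-exactly : ∀ {k} c (π : Type k) → qr (exactly c π) ≤ c + 1
qr-exactly zero π = qr-atMost 0 π
qr-exactly (suc j) π = ⊔-lub (≤-trans (qr-moreThan j π) (+-monoˡ-≤ 1 (n≤1+n j))) (qr-atMost (suc j) π)

⊤ᶠ : ∀ {k} → Sentence k
⊤ᶠ = all (eq zero zero)

pinned : ∀ {k n} → Model k n → List (Type k) → Sentence k
pinned M πs = ⋀ (map (λ π → exactly (count M π) π) πs) ⊤ᶠ

⊨-pinned : ∀ {k n} (M M′ : Model k n) → Fin n → ∀ πs →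
           M′ ⊨ pinned M πs ⇔ All (λ π → count M′ π ≡ count M π) πs
⊨-pinned M M′ a πs = ⇔-trans (Sat-⋀ M′ _ _ _) (mk⇔
  (λ (s , _) → All.map (λ {π} → to (⊨-exactly M′ a π (count M π))) (All.map⁻ s))
  (λ agree → All.map⁺ (All.map (λ {π} → from (⊨-exactly M′ a π (count M π))) agree) , λ _ → refl))

size-pinned : ∀ {k n} (M : Model k n) πs →
              size (pinned M πs) ≤ 6 * sum (map (count M) πs) + length πs * (4 * k + 3) + 2
size-pinned M [] = ≤-refl
size-pinned {k} M (π ∷ πs) = ≤-trans (s≤s (+-mono-≤ (size-exactly (count M π) π) (size-pinned M πs)))
                                     (≤-reflexive (arith (count M π) (sum (map (count M) πs)) (length πs) k))
  where
  arith : ∀ c s l k → suc (6 * c + 4 * k + 2 + (6 * s + l * (4 * k + 3) + 2))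
                      ≡ 6 * (c + s) + suc l * (4 * k + 3) + 2
  arith = solve-∀

qr-pinned : ∀ {k n q} (M : Model k n) {πs} → All (λ π → count M π ≤ q) πs → qr (pinned M πs) ≤ suc q
qr-pinned {q = q} M counts≤ = qr-⋀ (All.map⁺ (All.map qr≤ counts≤)) (s≤s z≤n)
  where
  qr≤ : ∀ {π} → count M π ≤ q → qr (exactly (count M π) π) ≤ suc q
  qr≤ {π} c≤q = ≤-trans (qr-exactly (count M π) π) (≤-trans (≤-reflexive (+-comm _ 1)) (s≤s c≤q))

otherTypes-agree⇒agree : ∀ {k n} (M M′ : Model k n) π₀ → All (λ π → count M′ π ≡ count M π) (otherTypes π₀) →
                         ∀ π → count M π ≡ count M′ π
otherTypes-agree⇒agree {n = n} M M′ π₀ agree π with π ≟ᵀ π₀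
... | no π≢π₀ = sym (All.lookup agree (∈-filter⁺ (λ π → ¬? (π ≟ᵀ π₀)) (∈-allSubsets π) π≢π₀))
... | yes refl = +-cancelʳ-≡ (sum (map (count M) (otherTypes π))) (count M π) (count M′ π) (begin
  count M π + sum (map (count M) (otherTypes π))     ≡⟨ count+sum-otherTypes M π ⟩
  n                                                  ≡⟨ sym (count+sum-otherTypes M′ π) ⟩
  count M′ π + sum (map (count M′) (otherTypes π))   ≡⟨ cong (λ ns → count M′ π + sum ns) (map-cong-local agree) ⟩
  count M′ π + sum (map (count M) (otherTypes π))    ∎)
  where open ≡-Reasoning

pinned-defines : ∀ {k n} d (M : Model k n) π₀ → Fin n → sum (map (count M) (otherTypes π₀)) < d →
                 Defines d M (pinned M (otherTypes π₀))
pinned-defines d M π₀ a rest<d M′ =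
  (λ M′⊨ π _ → otherTypes-agree⇒agree M M′ π₀ (to (⊨-pinned M M′ a (otherTypes π₀)) M′⊨) π) ,
  (λ M≡M′ → from (⊨-pinned M M′ a (otherTypes π₀))
                 (All.tabulate (λ {π} π∈ → sym (M≡M′ π (≤-<-trans (∈⇒≤sum-map (count M) π∈) rest<d)))))

2^k*[4k+3]≤3+cτ : ∀ k → 2 ^ k * (4 * k + 3) ≤ 3 + cτ k
2^k*[4k+3]≤3+cτ zero = ≤-refl
2^k*[4k+3]≤3+cτ (suc k) = ≤-trans (m≤m+n (p * (4 * suc k + 3)) (p * (11 * k + 8) + 3)) (≤-reflexive (arith k p))
  where
  p = 2 ^ suc k
  arith : ∀ k p → p * (4 * suc k + 3) + (p * (11 * k + 8) + 3) ≡ 3 + 15 * suc k * p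
  arith = solve-∀

dominant⇒definable : ∀ {k n} d (M : Model k n) h → h < d → Fin n → ∀ π₀ → n < h + count M π₀ →
  Σ (Sentence k) (λ φ → qr φ ≤ d × Defines d M φ × size φ < 6 * h + cτ k)
dominant⇒definable {k} {n} d M h h<d a π₀ dominant =
  pinned M (otherTypes π₀) , qr≤d , pinned-defines d M π₀ a (<-trans rest<h h<d) , size<
  where
  rest = sum (map (count M) (otherTypes π₀))
  rest<h : rest < h
  rest<h = +-cancelˡ-< (count M π₀) rest h (≤-trans (s≤s (≤-reflexive (count+sum-otherTypes M π₀)))
                                                    (≤-trans dominant (≤-reflexive (+-comm h (count M π₀)))))
  qr≤d : qr (pinned M (otherTypes π₀)) ≤ d
  qr≤d = ≤-trans (qr-pinned M {otherTypes π₀} (All.tabulate (∈⇒≤sum-map (count M)))) (≤-trans rest<h (<⇒≤ h<d))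
  size< : size (pinned M (otherTypes π₀)) < 6 * h + cτ k
  size< = begin-strict
    size (pinned M (otherTypes π₀))
      ≤⟨ size-pinned M (otherTypes π₀) ⟩
    6 * rest + length (otherTypes π₀) * (4 * k + 3) + 2
      ≤⟨ +-monoˡ-≤ 2 (+-monoʳ-≤ (6 * rest) (*-monoˡ-≤ (4 * k + 3) (length-otherTypes π₀))) ⟩
    6 * rest + 2 ^ k * (4 * k + 3) + 2
      ≤⟨ +-monoˡ-≤ 2 (+-monoʳ-≤ (6 * rest) (2^k*[4k+3]≤3+cτ k)) ⟩
    6 * rest + (3 + cτ k) + 2
      <⟨ ≤-reflexive (arith rest (cτ k)) ⟩
    6 * suc rest + cτ k
      ≤⟨ +-monoˡ-≤ (cτ k) (*-monoʳ-≤ 6 rest<h) ⟩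
    6 * h + cτ k ∎
    where
    open ≤-Reasoning
    arith : ∀ r c → suc (6 * r + (3 + c) + 2) ≡ 6 * suc r + c
    arith = solve-∀

dominant⊎spread : ∀ {k n} (M : Model k n) h → (∃ λ π₀ → n < h + count M π₀) ⊎ (∀ π → count M π ≤ n ∸ h)
dominant⊎spread {n = n} M h with anySubset? (λ π → n <? h + count M π)
... | yes dominant = inj₁ dominant
... | no ¬dominant = inj₂ λ π →
  m+n≤o⇒m≤o∸n (count M π) (≤-trans (≤-reflexive (+-comm (count M π) h)) (≮⇒≥ (λ n< → ¬dominant (π , n<))))

theorem10 : (k d n : ℕ) → 1 ≤ d → (M : Model k n) → (h : ℕ) → 1 ≤ h → h < d →
    classSize d M < n C h →
    Σ (Sentence k) (λ φ → qr φ ≤ d × Defines d M φ × size φ < 6 * h + cτ k)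
theorem10 k d n _ M h 1≤h h<d small =
  [ (λ (π₀ , dominant) → dominant⇒definable d M h h<d (fromℕ< (≤-trans 1≤h h≤n)) π₀ dominant)
  , (λ spread → contradiction (binomial≤classSize d M h h≤n spread) (<⇒≱ small))
  ]′ (dominant⊎spread M h)
  where
  h≤n : h ≤ n
  h≤n = ≮⇒≥ (λ n<h → n≮0 (subst (classSize d M <_) (k>n⇒nCk≡0 n<h) small))
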